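{- Let $\phi=(1+\sqrt5)/2$. For every integer $k\ge1$, $$\sum_{n=1}^{F_k-1}\lfloor\phi n\rfloor=\frac12(F_{k+1}-1)(F_k-1),\qquad \sum_{n=1}^{F_k-1}\lfloor\phi^2 n\rfloor=\frac12(F_{k+2}-1)(F_k-1).$$
   Context: $\lfloor x\rfloor$ denotes the integer part of $x$; an empty sum is $0$. The Fibonacci numbers are defined by $F_0=0$, $F_1=1$, $F_{n+2}=F_{n+1}+F_n$. -}

module Defs where

open import Data.Nat using (ℕ; zero; suc)
import Data.Nat as ℕ
open import Data.Integer using (ℤ; +_; _-_; _*_; _≤_; _<_)
  renaming (_+_ to _+ℤ_)
open import Data.Product using (_×_; _,_)
open import Data.Sum using (_⊎_)
open import Relation.Nullary using (¬_)

F : ℕ → ℕ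
F zero = 0
F (suc zero) = 1
F (suc (suc n)) = F (suc n) ℕ.+ F n

sumFrom1 : ℕ → (ℕ → ℕ) → ℕ
sumFrom1 zero f = 0
sumFrom1 (suc N) f = sumFrom1 N f ℕ.+ f (suc N)

-- Exact real numbers of the form a + b√5 (a, b integers), as pairs (a , b).
ℤ√5 : Set
ℤ√5 = ℤ × ℤ

-- 0 ≤ a + b√5, unfolded by cases on the signs of a and b.
NonNeg : ℤ√5 → Set
NonNeg (a , b) =
    (+ 0 ≤ a × + 0 ≤ b)
  ⊎ (+ 0 ≤ a × b < + 0 × + 5 * (b * b) ≤ a * a)
  ⊎ (a < + 0 × + 0 ≤ b × a * a ≤ + 5 * (b * b))

_≤√_ : ℤ√5 → ℤ√5 → Set
(a , b) ≤√ (c , d) = NonNeg (c - a , d - b)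

_<√_ : ℤ√5 → ℤ√5 → Set
x <√ y = ¬ (y ≤√ x)

-- m = ⌊ x / 2 ⌋ for x ∈ ℤ[√5], i.e.  m ≤ x/2 < m + 1,  i.e.  2m ≤ x < 2m + 2.
IsFloorHalf : ℕ → ℤ√5 → Set
IsFloorHalf m x = (+ (2 ℕ.* m) , + 0) ≤√ x × x <√ (+ (2 ℕ.* m ℕ.+ 2) , + 0)

-- φ = (1 + √5)/2, so 2·(φ n) = n + n√5  and  2·(φ² n) = 3n + n√5  (φ² = (3 + √5)/2).
twiceφ : ℕ → ℤ√5
twiceφ n = (+ n , + n)

twiceφ² : ℕ → ℤ√5
twiceφ² n = (+ (3 ℕ.* n) , + n)

IsFloorφ : ℕ → ℕ → Set
IsFloorφ n m = IsFloorHalf m (twiceφ n)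

IsFloorφ² : ℕ → ℕ → Set
IsFloorφ² n m = IsFloorHalf m (twiceφ² n)

-- Let a = F (k+1), b = F k, c = F (k−1). Cassini's identity a c − b² = ±1 makes b/c and a/b Farey
-- neighbours, with φ strictly between them; so no fraction with denominator n < b lies in between.
-- For 0 < n < b, the fractions ⌊φ n⌋/n ≤ φ < (⌊φ n⌋+1)/n therefore sit strictly on either side of
-- a/b, i.e. ⌊φ n⌋ < a n / b < ⌊φ n⌋ + 1. As a n/b + a (b−n)/b = a, this gives
-- ⌊φ n⌋ + ⌊φ (b−n)⌋ = a − 1, and pairing n with b − n sums the first series; the second follows
-- from ⌊φ² n⌋ = ⌊φ n⌋ + n. Orders against φ are decided with the form Q x y = x² − x y − y².
module Submission where

open import Defs
open import Relation.Binary.PropositionalEquality using (_≡_; refl; sym; trans; cong; cong₂; subst; subst₂; module ≡-Reasoning)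
open import Data.Product using (_×_; _,_; proj₁; proj₂)

module GoldenForm where

  import Data.Nat as ℕ
  open import Data.Nat using (ℕ; z≤n; s≤s)
  import Data.Nat.Properties as ℕ
  open import Data.Integer
  open import Data.Integer.Properties
  open import Data.Integer.Tactic.RingSolver using (solve-∀)
  open import Data.Sum using (_⊎_; inj₁; inj₂)
  open import Data.Empty using (⊥-elim)
  open import Relation.Nullary using (yes; no)

  private variable
    b c m n p q u v x r s t w : ℤ

  nonNeg*nonNeg : 0ℤ ≤ u → 0ℤ ≤ v → 0ℤ ≤ u * v
  nonNeg*nonNeg {+ i} {+ j} _ _ = subst (0ℤ ≤_) (pos-* i j) (+≤+ z≤n)

  nonNeg*nonPos : 0ℤ ≤ u → v ≤ 0ℤ → u * v ≤ 0ℤ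
  nonNeg*nonPos {u} {v} 0≤u v≤0 =
    subst (_≤ 0ℤ) (neg-involutive (u * v))
      (neg-mono-≤ (subst (0ℤ ≤_) (sym (neg-distribʳ-* u v)) (nonNeg*nonNeg 0≤u (neg-mono-≤ v≤0))))

  pos*pos : 0ℤ < u → 0ℤ < v → 0ℤ < u * v
  pos*pos {+[1+ i ]} {+[1+ j ]} _ _ = +<+ (s≤s z≤n)
  pos*pos {+0} (+<+ ()) _
  pos*pos {_} {+0} _ (+<+ ())

  pos*neg : 0ℤ < u → v < 0ℤ → u * v < 0ℤ
  pos*neg {+[1+ i ]} { -[1+ j ]} _ _ = -<+
  pos*neg {+0} (+<+ ()) _
  pos*neg {_} {+ j} _ (+<+ ())

  -- Q x y = (x − φ y)(x + y / φ): for x ≥ 0 < y its sign is the sign of x / y − φ.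
  Q : ℤ → ℤ → ℤ
  Q x y = x * x - x * y - y * y

  QFloor : ℤ → ℤ → Set
  QFloor m n = Q m n ≤ 0ℤ × 0ℤ < Q (m + 1ℤ) n

  -- Identities for the ring solver are stated with Q unfolded: the solver does not look through Q.
  Q-cross : ∀ p q m n → q * q * (m * m - m * n - n * n) - n * n * (p * p - p * q - q * q) ≡
    (q * m + (p - q) * n) * (q * m - p * n)
  Q-cross = solve-∀

  cross-factor-nonNeg : 0ℤ ≤ q → q ≤ p → 0ℤ ≤ m → 0ℤ ≤ n → 0ℤ ≤ q * m + (p - q) * n
  cross-factor-nonNeg 0≤q q≤p 0≤m 0≤n = +-mono-≤ (nonNeg*nonNeg 0≤q 0≤m) (nonNeg*nonNeg (i≤j⇒0≤j-i q≤p) 0≤n)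

  Q-ratio-≤ : 0ℤ ≤ q → q ≤ p → 0ℤ ≤ m → 0ℤ ≤ n → p * n ≤ q * m → n * n * Q p q ≤ q * q * Q m n
  Q-ratio-≤ {q} {p} {m} {n} 0≤q q≤p 0≤m 0≤n pn≤qm =
    0≤i-j⇒j≤i (subst (0ℤ ≤_) (sym (Q-cross p q m n))
      (nonNeg*nonNeg (cross-factor-nonNeg 0≤q q≤p 0≤m 0≤n) (i≤j⇒0≤j-i pn≤qm)))

  Q-ratio-≥ : 0ℤ ≤ q → q ≤ p → 0ℤ ≤ m → 0ℤ ≤ n → q * m ≤ p * n → q * q * Q m n ≤ n * n * Q p q
  Q-ratio-≥ {q} {p} {m} {n} 0≤q q≤p 0≤m 0≤n qm≤pn =
    i-j≤0⇒i≤j (subst (_≤ 0ℤ) (sym (Q-cross p q m n))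
      (nonNeg*nonPos (cross-factor-nonNeg 0≤q q≤p 0≤m 0≤n) (i≤j⇒i-j≤0 qm≤pn)))

  Q-separates-< : 0ℤ ≤ q → q ≤ p → 0ℤ ≤ m → 0ℤ < n → Q m n ≤ 0ℤ → 0ℤ < Q p q → q * m < p * n
  Q-separates-< {q} 0≤q q≤p 0≤m 0<n Qmn≤0 0<Qpq = ≰⇒> λ pn≤qm →
    <⇒≱ (pos*pos (pos*pos 0<n 0<n) 0<Qpq)
      (≤-trans (Q-ratio-≤ 0≤q q≤p 0≤m (<⇒≤ 0<n) pn≤qm) (nonNeg*nonPos (nonNeg*nonNeg 0≤q 0≤q) Qmn≤0))

  Q-separates-> : 0ℤ ≤ q → q ≤ p → 0ℤ ≤ m → 0ℤ < n → 0ℤ < Q m n → Q p q < 0ℤ → p * n < q * m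
  Q-separates-> {q} 0≤q q≤p 0≤m 0<n 0<Qmn Qpq<0 = ≰⇒> λ qm≤pn →
    <⇒≱ (pos*neg (pos*pos 0<n 0<n) Qpq<0)
      (≤-trans (nonNeg*nonNeg (nonNeg*nonNeg 0≤q 0≤q) (<⇒≤ 0<Qmn)) (Q-ratio-≥ 0≤q q≤p 0≤m (<⇒≤ 0<n) qm≤pn))

  -- Q (b + c) b = (b + c) c − b², so this is Cassini's identity for consecutive Fibonacci numbers c, b.
  Cassini : ℤ → ℤ → Set
  Cassini b c = Q (b + c) b ≡ 1ℤ ⊎ Q (b + c) b ≡ -1ℤ

  Q-step : ∀ b c → (b + c) * (b + c) - (b + c) * b - b * b ≡ - (b * b - b * c - c * c)
  Q-step = solve-∀

  Q-step′ : ∀ b c {e} → Q (b + c) b ≡ e → Q b c ≡ - e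
  Q-step′ b c refl = trans (sym (neg-involutive (Q b c))) (cong -_ (sym (Q-step b c)))

  Cassini-step : Cassini b c → Cassini (b + c) b
  Cassini-step {b} {c} (inj₁ Q≡1) = inj₂ (trans (Q-step (b + c) b) (cong -_ Q≡1))
  Cassini-step {b} {c} (inj₂ Q≡-1) = inj₁ (trans (Q-step (b + c) b) (cong -_ Q≡-1))

  cassini : ∀ j → Cassini (+ F (ℕ.suc j)) (+ F j)
  cassini ℕ.zero = inj₂ refl
  cassini (ℕ.suc j) = subst (λ a → Cassini a (+ F (ℕ.suc j))) (sym (pos-+ (F (ℕ.suc j)) (F j)))
    (Cassini-step {+ F (ℕ.suc j)} {+ F j} (cassini j))

  ≤-lincomb : 0ℤ ≤ b → 0ℤ ≤ c → r ≤ s → t < w → b ≤ c * (s - r) + b * (w - t)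
  ≤-lincomb {b} {c} {r} {s} {t} {w} 0≤b 0≤c r≤s t<w =
    0≤i-j⇒j≤i (subst (0ℤ ≤_) (shift b c (s - r) w t)
      (+-mono-≤ (nonNeg*nonNeg 0≤c (i≤j⇒0≤j-i r≤s)) (nonNeg*nonNeg 0≤b (i≤j⇒0≤j-i (i<j⇒suc[i]≤j t<w)))))
    where
    shift : ∀ b c d w t → c * d + b * (w - (1ℤ + t)) ≡ c * d + b * (w - t) - b
    shift = solve-∀

  Q-neighbours⁺ : ∀ b c M n → n * ((b + c) * (b + c) - (b + c) * b - b * b) ≡
    c * ((b + c) * n - b * M) + b * (c * M - b * n)
  Q-neighbours⁺ = solve-∀

  Q-neighbours⁻ : ∀ b c M n → - (n * ((b + c) * (b + c) - (b + c) * b - b * b)) ≡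
    c * (b * M - (b + c) * n) + b * (b * n - c * M)
  Q-neighbours⁻ = solve-∀

  -- b/c and (b+c)/b are Farey neighbours, so a fraction M/n strictly between them has n ≥ b.
  neighbour-gap⁺ : ∀ {M} → Q (b + c) b ≡ 1ℤ → 0ℤ ≤ b → 0ℤ ≤ c →
    b * M ≤ (b + c) * n → b * n < c * M → b ≤ n
  neighbour-gap⁺ {b} {c} {n} {M} Q≡1 0≤b 0≤c bM≤an bn<cM =
    subst (b ≤_) (trans (sym (Q-neighbours⁺ b c M n)) (trans (cong (n *_) Q≡1) (*-identityʳ n)))
      (≤-lincomb 0≤b 0≤c bM≤an bn<cM)

  neighbour-gap⁻ : ∀ {M} → Q (b + c) b ≡ -1ℤ → 0ℤ ≤ b → 0ℤ ≤ c →
    (b + c) * n ≤ b * M → c * M < b * n → b ≤ n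
  neighbour-gap⁻ {b} {c} {n} {M} Q≡-1 0≤b 0≤c an≤bM cM<bn =
    subst (b ≤_) (trans (sym (Q-neighbours⁻ b c M n)) (trans (cong (λ e → - (n * e)) Q≡-1) (n*-1≡n n)))
      (≤-lincomb 0≤b 0≤c an≤bM cM<bn)
    where
    n*-1≡n : ∀ n → - (n * -1ℤ) ≡ n
    n*-1≡n = solve-∀

  convergent-bounds : Cassini b c → 0ℤ ≤ c → c ≤ b → 0ℤ ≤ m → 0ℤ < n → n < b → QFloor m n →
    b * m < (b + c) * n × (b + c) * n < b * (m + 1ℤ)
  convergent-bounds {b} {c} {m} {n} cas 0≤c c≤b 0≤m 0<n n<b (Qm≤0 , 0<QM) = bounds cas
    where
    0≤b : 0ℤ ≤ b
    0≤b = ≤-trans 0≤c c≤b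
    b≤a : b ≤ b + c
    b≤a = subst (_≤ b + c) (+-identityʳ b) (+-monoʳ-≤ b 0≤c)
    0≤M : 0ℤ ≤ m + 1ℤ
    0≤M = +-mono-≤ 0≤m (+≤+ z≤n)
    bounds : Cassini b c → b * m < (b + c) * n × (b + c) * n < b * (m + 1ℤ)
    bounds (inj₁ Qa≡1) =
        Q-separates-< 0≤b b≤a 0≤m 0<n Qm≤0 (subst (0ℤ <_) (sym Qa≡1) (+<+ (s≤s z≤n)))
      , ≰⇒> λ bM≤an → <⇒≱ n<b (neighbour-gap⁺ Qa≡1 0≤b 0≤c bM≤an
          (Q-separates-> 0≤c c≤b 0≤M 0<n 0<QM (subst (_< 0ℤ) (sym (Q-step′ b c Qa≡1)) -<+)))
    bounds (inj₂ Qa≡-1) =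
        ≰⇒> (λ an≤bm → <⇒≱ n<b (neighbour-gap⁻ Qa≡-1 0≤b 0≤c an≤bm
          (Q-separates-< 0≤c c≤b 0≤m 0<n Qm≤0 (subst (0ℤ <_) (sym (Q-step′ b c Qa≡-1)) (+<+ (s≤s z≤n))))))
      , Q-separates-> 0≤b b≤a 0≤M 0<n 0<QM (subst (_< 0ℤ) (sym Qa≡-1) -<+)

  floors-of-complements : ∀ (b : ℕ) {a n₁ n₂ x y} → n₁ + n₂ ≡ + b →
    + b * x < a * n₁ → a * n₁ < + b * (x + 1ℤ) →
    + b * y < a * n₂ → a * n₂ < + b * (y + 1ℤ) → x + y + 1ℤ ≡ a
  floors-of-complements b {a} {n₁} {n₂} {x} {y} n₁+n₂≡b bx<an₁ an₁<bx′ by<an₂ an₂<by′ =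
    ≤-antisym (subst (_≤ a) (+-comm 1ℤ (x + y)) (i<j⇒suc[i]≤j x+y<a))
              (subst (a ≤_) (pred-+2 (x + y)) (i<j⇒i≤pred[j] a<x+y+2))
    where
    a[n₁+n₂]≡ba : a * n₁ + a * n₂ ≡ + b * a
    a[n₁+n₂]≡ba = trans (sym (*-distribˡ-+ a n₁ n₂)) (trans (cong (a *_) n₁+n₂≡b) (*-comm a (+ b)))
    x+y<a : x + y < a
    x+y<a = *-cancelˡ-<-nonNeg (+ b)
      (subst₂ _<_ (sym (*-distribˡ-+ (+ b) x y)) a[n₁+n₂]≡ba (+-mono-< bx<an₁ by<an₂))
    a<x+y+2 : a < x + y + + 2
    a<x+y+2 = *-cancelˡ-<-nonNeg (+ b)
      (subst₂ _<_ a[n₁+n₂]≡ba (sum-succ (+ b) x y) (+-mono-< an₁<bx′ an₂<by′))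
      where
      sum-succ : ∀ b x y → b * (x + 1ℤ) + b * (y + 1ℤ) ≡ b * (x + y + + 2)
      sum-succ = solve-∀
    pred-+2 : ∀ z → -1ℤ + (z + + 2) ≡ z + 1ℤ
    pred-+2 = solve-∀

  -- 4 Q x v is the norm (v − 2x)² − 5v² of 2(φ v − x) = (v − 2x) + v√5.
  Q-norm : ∀ x v → + 4 * (x * x - x * v - v * v) ≡ (v - + 2 * x) * (v - + 2 * x) - + 5 * (v * v)
  Q-norm = solve-∀

  nonNeg⇒Q≤0 : 0ℤ ≤ v → 0ℤ ≤ x → NonNeg (v - + 2 * x , v) → Q x v ≤ 0ℤ
  nonNeg⇒Q≤0 {v} {x} 0≤v 0≤x (inj₁ (0≤u , _)) =
    subst (_≤ 0ℤ) (sym (Q-neg x v))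
      (neg-mono-≤ (+-mono-≤ (nonNeg*nonNeg 0≤x (+-mono-≤ 0≤u 0≤x)) (nonNeg*nonNeg 0≤v 0≤v)))
    where
    Q-neg : ∀ x v → x * x - x * v - v * v ≡ - (x * ((v - + 2 * x) + x) + v * v)
    Q-neg = solve-∀
  nonNeg⇒Q≤0 0≤v _ (inj₂ (inj₁ (_ , v<0 , _))) = ⊥-elim (<⇒≱ v<0 0≤v)
  nonNeg⇒Q≤0 {v} {x} _ _ (inj₂ (inj₂ (_ , _ , u²≤5v²))) =
    *-cancelˡ-≤-pos (Q x v) 0ℤ (+ 4) (subst (_≤ 0ℤ) (sym (Q-norm x v)) (i≤j⇒i-j≤0 u²≤5v²))

  Q≤0⇒nonNeg : 0ℤ ≤ v → Q x v ≤ 0ℤ → NonNeg (v - + 2 * x , v)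
  Q≤0⇒nonNeg {v} {x} 0≤v Q≤0 with 0ℤ ≤? v - + 2 * x
  ... | yes 0≤u = inj₁ (0≤u , 0≤v)
  ... | no 0≰u = inj₂ (inj₂ (≰⇒> 0≰u , 0≤v ,
          i-j≤0⇒i≤j (subst (_≤ 0ℤ) (Q-norm x v) (*-monoˡ-≤-nonNeg (+ 4) Q≤0))))

  floorφ⇒QFloor : ∀ {n m} → IsFloorφ n m → QFloor (+ m) (+ n)
  floorφ⇒QFloor {n} {m} (lower , upper) =
      nonNeg⇒Q≤0 {x = + m} (+≤+ z≤n) (+≤+ z≤n) (subst NonNeg (coordinates (pos-* 2 m)) lower)
    , ≰⇒> λ Q≤0 → upper (subst NonNeg (sym (coordinates 2m+2≡)) (Q≤0⇒nonNeg {x = + m + 1ℤ} (+≤+ z≤n) Q≤0))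
    where
    coordinates : ∀ {s t} → s ≡ t → (+ n - s , + n - + 0) ≡ (+ n - t , + n)
    coordinates s≡t = cong₂ _,_ (cong (λ s → + n - s) s≡t) (+-identityʳ (+ n))
    2m+2≡ : + (2 ℕ.* m ℕ.+ 2) ≡ + 2 * (+ m + 1ℤ)
    2m+2≡ = trans (pos-+ (2 ℕ.* m) 2) (trans (cong (_+ + 2) (pos-* 2 m)) (double-succ (+ m)))
      where
      double-succ : ∀ z → + 2 * z + + 2 ≡ + 2 * (z + 1ℤ)
      double-succ = solve-∀

  minus-cancelˡ : ∀ k {a b c d} → a ≡ k ℕ.+ c → b ≡ k ℕ.+ d → + a - + b ≡ + c - + d
  minus-cancelˡ k {c = c} {d} refl refl =
    trans (m-n≡m⊖n (k ℕ.+ c) (k ℕ.+ d)) (trans (+-cancelˡ-⊖ k c d) (sym (m-n≡m⊖n c d)))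

  floorφ²⇒floorφ : ∀ {n m} → IsFloorφ² n m → n ℕ.≤ m × IsFloorφ n (m ℕ.∸ n)
  floorφ²⇒floorφ {n} {m} (lower , upper) with n ℕ.≤? m
  ... | no n≰m = ⊥-elim (upper (inj₁ (i≤j⇒0≤j-i (+≤+ 2m+2≤3n) , +≤+ z≤n)))
    where
    2m+2≤3n : 2 ℕ.* m ℕ.+ 2 ℕ.≤ 3 ℕ.* n
    2m+2≤3n = subst (ℕ._≤ 3 ℕ.* n) (trans (ℕ.*-suc 2 m) (ℕ.+-comm 2 (2 ℕ.* m)))
      (ℕ.≤-trans (ℕ.*-monoʳ-≤ 2 (ℕ.≰⇒> n≰m)) (ℕ.m≤n+m (2 ℕ.* n) n))
  ... | yes n≤m with m ℕ.∸ n | ℕ.m+[n∸m]≡n n≤m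
  ... | d | refl =
      n≤m
    , subst NonNeg (coordinates (ℕ.*-distribˡ-+ 2 n d)) lower
    , λ nonNeg → upper (subst NonNeg (sym (coordinates 2[n+d]+2≡)) nonNeg)
    where
    coordinates : ∀ {s t} → s ≡ 2 ℕ.* n ℕ.+ t → (+ (3 ℕ.* n) - + s , + n - + 0) ≡ (+ n - + t , + n - + 0)
    coordinates s≡ = cong (_, + n - + 0) (minus-cancelˡ (2 ℕ.* n) (ℕ.+-comm n (2 ℕ.* n)) s≡)
    2[n+d]+2≡ : 2 ℕ.* (n ℕ.+ d) ℕ.+ 2 ≡ 2 ℕ.* n ℕ.+ (2 ℕ.* d ℕ.+ 2)
    2[n+d]+2≡ = trans (cong (ℕ._+ 2) (ℕ.*-distribˡ-+ 2 n d)) (ℕ.+-assoc (2 ℕ.* n) (2 ℕ.* d) 2)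

  floorφ-pair : ∀ {B C} → Cassini (+ B) (+ C) → C ℕ.≤ B → (f : ℕ → ℕ) → (∀ n → IsFloorφ n (f n)) →
    ∀ {n} → 1 ℕ.≤ n → n ℕ.< B → f n ℕ.+ f (B ℕ.∸ n) ≡ B ℕ.+ C ℕ.∸ 1
  floorφ-pair {B} {C} cas C≤B f floor {n} 1≤n n<B =
    trans (sym (ℕ.m+n∸n≡m _ 1)) (cong (ℕ._∸ 1) (+-injective sum≡))
    where
    open ≡-Reasoning
    bounds : ∀ k → 1 ℕ.≤ k → k ℕ.< B →
      + B * + f k < (+ B + + C) * + k × (+ B + + C) * + k < + B * (+ f k + 1ℤ)
    bounds k 1≤k k<B = convergent-bounds cas (+≤+ z≤n) (+≤+ C≤B) (+≤+ z≤n) (+<+ 1≤k) (+<+ k<B)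
      (floorφ⇒QFloor {k} {f k} (floor k))
    n≤B : n ℕ.≤ B
    n≤B = ℕ.<⇒≤ n<B
    b₁ = bounds n 1≤n n<B
    b₂ = bounds (B ℕ.∸ n) (ℕ.m<n⇒0<n∸m n<B) (ℕ.∸-monoʳ-< 1≤n n≤B)
    complement : + n + + (B ℕ.∸ n) ≡ + B
    complement = trans (sym (pos-+ n (B ℕ.∸ n))) (cong +_ (ℕ.m+[n∸m]≡n n≤B))
    sum≡ : + (f n ℕ.+ f (B ℕ.∸ n) ℕ.+ 1) ≡ + (B ℕ.+ C)
    sum≡ = begin
      + (f n ℕ.+ f (B ℕ.∸ n) ℕ.+ 1)   ≡⟨ trans (pos-+ _ 1) (cong (_+ 1ℤ) (pos-+ (f n) _)) ⟩
      + f n + + f (B ℕ.∸ n) + 1ℤ      ≡⟨ floors-of-complements B complement (proj₁ b₁) (proj₂ b₁) (proj₁ b₂) (proj₂ b₂) ⟩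
      + B + + C                       ≡⟨ pos-+ B C ⟨
      + (B ℕ.+ C)                     ∎

open GoldenForm using (Cassini; cassini; floorφ-pair; floorφ²⇒floorφ)
import Data.Integer as ℤ
open import Data.Nat using (ℕ; zero; suc; _+_; _*_; _∸_; _≤_; _<_; _≥_; z≤n; s≤s)
open import Data.Nat.Properties
  using (+-comm; +-assoc; +-identityʳ; *-comm; *-zeroʳ; m+[n∸m]≡n; m∸n+n≡m; +-∸-comm;
         m≤n⇒m≤1+n; ≤-refl; ≤-trans; <⇒≤; m≤m+n)
open import Data.Nat.Tactic.RingSolver using (solve-∀)

sumFrom1-unroll : ∀ N (h : ℕ → ℕ) → sumFrom1 (suc N) h ≡ h 1 + sumFrom1 N (λ n → h (suc n))
sumFrom1-unroll zero h = sym (+-identityʳ (h 1))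
sumFrom1-unroll (suc N) h = trans (cong (_+ h (suc (suc N))) (sumFrom1-unroll N h)) (+-assoc (h 1) _ _)

sumFrom1-reverse : ∀ N (h : ℕ → ℕ) → sumFrom1 N h ≡ sumFrom1 N (λ n → h (suc N ∸ n))
sumFrom1-reverse zero h = refl
sumFrom1-reverse (suc N) h = begin
  sumFrom1 N h + h (suc N)                             ≡⟨ cong (_+ h (suc N)) (sumFrom1-reverse N h) ⟩
  sumFrom1 N (λ n → h (suc N ∸ n)) + h (suc N)         ≡⟨ +-comm _ (h (suc N)) ⟩
  h (suc N) + sumFrom1 N (λ n → h (suc N ∸ n))         ≡⟨ sumFrom1-unroll N (λ n → h (suc (suc N) ∸ n)) ⟨
  sumFrom1 (suc N) (λ n → h (suc (suc N) ∸ n))         ∎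
  where open ≡-Reasoning

sumFrom1-+ : ∀ N (h h′ : ℕ → ℕ) → sumFrom1 N (λ n → h n + h′ n) ≡ sumFrom1 N h + sumFrom1 N h′
sumFrom1-+ zero h h′ = refl
sumFrom1-+ (suc N) h h′ =
  trans (cong (_+ (h (suc N) + h′ (suc N))) (sumFrom1-+ N h h′))
        (interchange (sumFrom1 N h) (sumFrom1 N h′) (h (suc N)) (h′ (suc N)))
  where
  interchange : ∀ a b c d → (a + b) + (c + d) ≡ (a + c) + (b + d)
  interchange = solve-∀

sumFrom1-const : ∀ N {h : ℕ → ℕ} {K} → (∀ {n} → 1 ≤ n → n ≤ N → h n ≡ K) → sumFrom1 N h ≡ N * K
sumFrom1-const zero _ = refl
sumFrom1-const (suc N) {h} {K} h≡K =
  trans (cong₂ _+_ (sumFrom1-const N (λ 1≤n n≤N → h≡K 1≤n (m≤n⇒m≤1+n n≤N))) (h≡K (s≤s z≤n) ≤-refl))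
        (+-comm (N * K) K)

sumFrom1-pairs : ∀ B {h : ℕ → ℕ} {K} → (∀ {n} → 1 ≤ n → n < B → h n + h (B ∸ n) ≡ K) →
  2 * sumFrom1 (B ∸ 1) h ≡ K * (B ∸ 1)
sumFrom1-pairs zero {K = K} _ = sym (*-zeroʳ K)
sumFrom1-pairs (suc N) {h} {K} pair≡K = begin
  2 * sumFrom1 N h                                     ≡⟨ cong (sumFrom1 N h +_) (+-identityʳ (sumFrom1 N h)) ⟩
  sumFrom1 N h + sumFrom1 N h                          ≡⟨ cong (sumFrom1 N h +_) (sumFrom1-reverse N h) ⟩
  sumFrom1 N h + sumFrom1 N (λ n → h (suc N ∸ n))      ≡⟨ sumFrom1-+ N h (λ n → h (suc N ∸ n)) ⟨
  sumFrom1 N (λ n → h n + h (suc N ∸ n))               ≡⟨ sumFrom1-const N (λ 1≤n n≤N → pair≡K 1≤n (s≤s n≤N)) ⟩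
  N * K                                                ≡⟨ *-comm N K ⟩
  K * N                                                ∎
  where open ≡-Reasoning

floorφ²-pair : ∀ {B C} → Cassini (ℤ.+ B) (ℤ.+ C) → C ≤ B → (g : ℕ → ℕ) → (∀ n → IsFloorφ² n (g n)) →
  ∀ {n} → 1 ≤ n → n < B → g n + g (B ∸ n) ≡ B + C + B ∸ 1
floorφ²-pair {B} {C} cas C≤B g floor {n} 1≤n n<B = begin
  g n + g (B ∸ n)                                      ≡⟨ cong₂ _+_ (sym (m∸n+n≡m (n≤g n))) (sym (m∸n+n≡m (n≤g (B ∸ n)))) ⟩
  (f n + n) + (f (B ∸ n) + (B ∸ n))                    ≡⟨ interchange (f n) n (f (B ∸ n)) (B ∸ n) ⟩
  (f n + f (B ∸ n)) + (n + (B ∸ n))                    ≡⟨ cong₂ _+_ (floorφ-pair cas C≤B f floorφ 1≤n n<B) (m+[n∸m]≡n (<⇒≤ n<B)) ⟩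
  (B + C ∸ 1) + B                                      ≡⟨ +-∸-comm B (≤-trans 1≤n (≤-trans (<⇒≤ n<B) (m≤m+n B C))) ⟨
  B + C + B ∸ 1                                        ∎
  where
  open ≡-Reasoning
  f : ℕ → ℕ
  f k = g k ∸ k
  n≤g : ∀ k → k ≤ g k
  n≤g k = proj₁ (floorφ²⇒floorφ {k} {g k} (floor k))
  floorφ : ∀ k → IsFloorφ k (f k)
  floorφ k = proj₂ (floorφ²⇒floorφ {k} {g k} (floor k))
  interchange : ∀ a b c d → (a + b) + (c + d) ≡ (a + c) + (b + d)
  interchange = solve-∀

F-mono : ∀ j → F j ≤ F (suc j)
F-mono zero = z≤n
F-mono (suc j) = m≤m+n (F (suc j)) (F j)

lemma2 : (k : ℕ) → k ≥ 1 →
    (f g : ℕ → ℕ) → (∀ n → IsFloorφ n (f n)) → (∀ n → IsFloorφ² n (g n)) →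
      (2 * sumFrom1 (F k ∸ 1) f ≡ (F (k + 1) ∸ 1) * (F k ∸ 1))
      × (2 * sumFrom1 (F k ∸ 1) g ≡ (F (k + 2) ∸ 1) * (F k ∸ 1))
lemma2 (suc j) _ f g floorφ floorφ² rewrite +-comm j 1 | +-comm j 2 =
    sumFrom1-pairs (F (suc j)) (floorφ-pair (cassini j) (F-mono j) f floorφ)
  , sumFrom1-pairs (F (suc j)) (floorφ²-pair (cassini j) (F-mono j) g floorφ²)
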